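{- Let $\mathcal{F}$ be the class of finite simple graphs $G$ such that $G$ or its complement is isomorphic to $K_m+\ell K_1$ (a clique on $m$ vertices together with $\ell$ isolated vertices) for some $m\geq 1$, $\ell\geq 0$. A graph $G$ is in $\mathcal{F}$ if and only if no induced subgraph of $G$ on $4$ vertices is isomorphic to any of the following graphs: $F_0=2K_2$ (two disjoint edges), $F_1=P_3+K_1$ (a path on three vertices plus an isolated vertex), $F_2=P_4$ (the path on four vertices), $F_3$ = the paw (a triangle with one pendant edge attached to one of its vertices), $F_4=C_4$ (the $4$-cycle).
   Context: $K_m+\ell K_1$ denotes the disjoint union of the complete graph $K_m$ with $\ell$ isolated vertices. -}

module Defs where

open import Data.Bool using (Bool; true; false; not; _∧_; _∨_; if_then_else_)
open import Data.Nat using (ℕ; zero; suc; _+_; _<ᵇ_; _≡ᵇ_; _≤_)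
open import Data.Fin using (Fin; toℕ; _≟_; zero; suc)
open import Data.Product using (Σ; ∃; ∃-syntax; _×_; _,_)
open import Data.Sum using (_⊎_)
open import Relation.Binary.PropositionalEquality using (_≡_; refl)
open import Relation.Nullary using (¬_)
open import Relation.Nullary.Decidable using (⌊_⌋)
open import Function.Bundles using (_↔_; Inverse)
open import Function.Definitions using (Injective)

record Graph (n : ℕ) : Set where
  field
    adj   : Fin n → Fin n → Bool
    adj-sym : ∀ u v → adj u v ≡ adj v u
    loopless : ∀ u → adj u u ≡ false
open Graph public

_≅_ : ∀ {n m} → Graph n → Graph m → Set
_≅_ {n} {m} G H = Σ (Fin n ↔ Fin m) λ φ →
  ∀ u v → adj G u v ≡ adj H (Inverse.to φ u) (Inverse.to φ v)

neq : ∀ {n} → Fin n → Fin n → Bool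
neq u v = not ⌊ u ≟ v ⌋

complement : ∀ {n} → Graph n → Graph n
complement {n} G = record
  { adj = λ u v → neq u v ∧ not (adj G u v)
  ; adj-sym = symc
  ; loopless = loopc }
  where
    open import Relation.Binary.PropositionalEquality using (sym; cong₂; cong)
    open import Relation.Nullary using (yes; no)
    symn : ∀ (u v : Fin n) → neq u v ≡ neq v u
    symn u v with u ≟ v | v ≟ u
    ... | yes _ | yes _ = refl
    ... | no _ | no _ = refl
    ... | yes p | no q = Data.Empty.⊥-elim (q (sym p)) where import Data.Empty
    ... | no p | yes q = Data.Empty.⊥-elim (p (sym q)) where import Data.Empty
    symc : ∀ u v → (neq u v ∧ not (adj G u v)) ≡ (neq v u ∧ not (adj G v u))
    symc u v = cong₂ _∧_ (symn u v) (cong not (Graph.adj-sym G u v))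
    loopc : ∀ u → (neq u u ∧ not (adj G u u)) ≡ false
    loopc u with u ≟ u
    ... | yes _ = refl
    ... | no ¬p = Data.Empty.⊥-elim (¬p refl) where import Data.Empty

-- K_m + ℓ K_1 on vertex set Fin (m + ℓ): vertices with index < m form a clique,
-- the remaining ℓ vertices are isolated.
KplusIso : (m ℓ : ℕ) → Graph (m + ℓ)
KplusIso m ℓ = record
  { adj = λ u v → neq u v ∧ (toℕ u <ᵇ m) ∧ (toℕ v <ᵇ m)
  ; adj-sym = symk
  ; loopless = loopk }
  where
    open import Relation.Binary.PropositionalEquality using (sym; cong₂; cong)
    open import Relation.Nullary using (yes; no)
    open import Data.Bool.Properties using (∧-comm)
    symn : ∀ (u v : Fin (m + ℓ)) → neq u v ≡ neq v u
    symn u v with u ≟ v | v ≟ u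
    ... | yes _ | yes _ = refl
    ... | no _ | no _ = refl
    ... | yes p | no q = Data.Empty.⊥-elim (q (sym p)) where import Data.Empty
    ... | no p | yes q = Data.Empty.⊥-elim (p (sym q)) where import Data.Empty
    symk : ∀ u v → (neq u v ∧ (toℕ u <ᵇ m) ∧ (toℕ v <ᵇ m)) ≡ (neq v u ∧ (toℕ v <ᵇ m) ∧ (toℕ u <ᵇ m))
    symk u v = cong₂ _∧_ (symn u v) (∧-comm (toℕ u <ᵇ m) (toℕ v <ᵇ m))
    loopk : ∀ u → (neq u u ∧ (toℕ u <ᵇ m) ∧ (toℕ u <ᵇ m)) ≡ false
    loopk u with u ≟ u
    ... | yes _ = refl
    ... | no ¬p = Data.Empty.⊥-elim (¬p refl) where import Data.Empty

InF : ∀ {n} → Graph n → Set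
InF G = ∃[ m ] ∃[ ℓ ] (1 ≤ m × (G ≅ KplusIso m ℓ ⊎ complement G ≅ KplusIso m ℓ))

induced : ∀ {n k} → Graph n → (e : Fin k → Fin n) → Graph k
induced G e = record
  { adj = λ i j → adj G (e i) (e j) ∧ neq i j
  ; adj-sym = λ i j → symi i j
  ; loopless = λ i → loopi i }
  where
    open import Relation.Binary.PropositionalEquality using (sym; cong₂)
    open import Relation.Nullary using (yes; no)
    symn : ∀ {k} (u v : Fin k) → neq u v ≡ neq v u
    symn u v with u ≟ v | v ≟ u
    ... | yes _ | yes _ = refl
    ... | no _ | no _ = refl
    ... | yes p | no q = Data.Empty.⊥-elim (q (sym p)) where import Data.Empty
    ... | no p | yes q = Data.Empty.⊥-elim (p (sym q)) where import Data.Empty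
    symi : ∀ i j → (adj G (e i) (e j) ∧ neq i j) ≡ (adj G (e j) (e i) ∧ neq j i)
    symi i j = cong₂ _∧_ (Graph.adj-sym G (e i) (e j)) (symn i j)
    open import Data.Bool.Properties using (∧-zeroʳ)
    loopi : ∀ i → (adj G (e i) (e i) ∧ neq i i) ≡ false
    loopi i with i ≟ i
    ... | yes _ = ∧-zeroʳ _
    ... | no ¬p = Data.Empty.⊥-elim (¬p refl) where import Data.Empty

-- Graphs on 4 vertices given by an edge predicate on vertex indices 0..3
-- (only pairs with a < b listed; symmetric closure taken).
edgeFn : (ℕ → ℕ → Bool) → Fin 4 → Fin 4 → Bool
edgeFn E u v = E (toℕ u) (toℕ v) ∨ E (toℕ v) (toℕ u)

mk4 : (E : ℕ → ℕ → Bool) → (∀ u v → edgeFn E u v ≡ edgeFn E v u) →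
      (∀ u → edgeFn E u u ≡ false) → Graph 4
mk4 E s l = record { adj = edgeFn E ; adj-sym = s ; loopless = l }

private
  p : ℕ → ℕ → ℕ → ℕ → Bool
  p a b x y = (x ≡ᵇ a) ∧ (y ≡ᵇ b)

E0 E1 E2 E3 E4 : ℕ → ℕ → Bool
E0 x y = p 0 1 x y ∨ p 2 3 x y
E1 x y = p 0 1 x y ∨ p 1 2 x y
E2 x y = p 0 1 x y ∨ p 1 2 x y ∨ p 2 3 x y
E3 x y = p 0 1 x y ∨ p 1 2 x y ∨ p 0 2 x y ∨ p 2 3 x y
E4 x y = p 0 1 x y ∨ p 1 2 x y ∨ p 2 3 x y ∨ p 0 3 x y

private
  symAll : (E : ℕ → ℕ → Bool) → ∀ u v → edgeFn E u v ≡ edgeFn E v u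
  symAll E u v = Data.Bool.Properties.∨-comm (E (toℕ u) (toℕ v)) (E (toℕ v) (toℕ u))
    where import Data.Bool.Properties

  l0 : ∀ u → edgeFn E0 u u ≡ false
  l0 zero = refl
  l0 (suc zero) = refl
  l0 (suc (suc zero)) = refl
  l0 (suc (suc (suc zero))) = refl
  l1 : ∀ u → edgeFn E1 u u ≡ false
  l1 zero = refl
  l1 (suc zero) = refl
  l1 (suc (suc zero)) = refl
  l1 (suc (suc (suc zero))) = refl
  l2 : ∀ u → edgeFn E2 u u ≡ false
  l2 zero = refl
  l2 (suc zero) = refl
  l2 (suc (suc zero)) = refl
  l2 (suc (suc (suc zero))) = refl
  l3 : ∀ u → edgeFn E3 u u ≡ false
  l3 zero = refl
  l3 (suc zero) = refl
  l3 (suc (suc zero)) = refl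
  l3 (suc (suc (suc zero))) = refl
  l4 : ∀ u → edgeFn E4 u u ≡ false
  l4 zero = refl
  l4 (suc zero) = refl
  l4 (suc (suc zero)) = refl
  l4 (suc (suc (suc zero))) = refl

F0 F1 F2 F3 F4 : Graph 4
F0 = mk4 E0 (symAll E0) l0
F1 = mk4 E1 (symAll E1) l1
F2 = mk4 E2 (symAll E2) l2
F3 = mk4 E3 (symAll E3) l3
F4 = mk4 E4 (symAll E4) l4

Forbidden4 : Graph 4 → Set
Forbidden4 H = H ≅ F0 ⊎ H ≅ F1 ⊎ H ≅ F2 ⊎ H ≅ F3 ⊎ H ≅ F4

HasForbiddenInduced : ∀ {n} → Graph n → Set
HasForbiddenInduced {n} G =
  Σ (Fin 4 → Fin n) λ e → Injective _≡_ _≡_ e × Forbidden4 (induced G e)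

-- A graph is K_m + ℓK₁ exactly when its non-isolated vertices are pairwise adjacent.
-- This property passes to induced subgraphs and to isomorphic copies, and each Fᵢ as
-- well as each complement of an Fᵢ violates it; that gives one direction.
-- Conversely, the property holds as soon as there is no induced P₃ and no induced 2K₂.
-- An {F₀,…,F₄}-free graph G has no induced 2K₂ = F₀. If it has no induced P₃ either we
-- are done. Otherwise take an induced P₃ p–q–r: excluding P₃+K₁, P₄ and C₄ forces q to
-- be adjacent to every other vertex, so excluding the paw rules out an induced K₂+K₁,
-- i.e. an induced P₃ of the complement; and the complement of 2K₂ is C₄. So the
-- complement of G has the property.

module Submission where

open import Data.Bool using (Bool; true; false; not; _∧_)
open import Data.Bool.Properties
  using (∧-conicalˡ; ∧-conicalʳ; ∧-identityʳ; ∧-zeroʳ; not-injective; not-involutive; T-≡)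
  renaming (_≟_ to _≟ᵇ_)
open import Data.Empty using (⊥; ⊥-elim)
open import Data.Fin using (Fin; zero; suc; toℕ; _≟_; join)
open import Data.Fin.Patterns using (0F; 1F; 2F; 3F)
open import Data.Fin.Properties using (any?; +↔⊎; toℕ-↑ˡ; toℕ-↑ʳ; toℕ<n)
open import Data.Nat using (ℕ; zero; suc; _+_; _≤_; _<ᵇ_; s≤s; z≤n)
open import Data.Nat.Properties using (≤-refl; ≤-trans; <⇒<ᵇ)
open import Data.Product using (∃-syntax; _×_; _,_; map₂)
open import Data.Sum using (_⊎_; inj₁; inj₂; [_,_]′; map₁; swap)
open import Data.Sum.Properties using (swap-↔)
open import Data.Vec using (_∷_; []; lookup)
open import Data.Vec.Relation.Unary.All using ([]; _∷_)
open import Data.Vec.Relation.Unary.AllPairs using ([]; _∷_)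
open import Data.Vec.Relation.Unary.Unique.Propositional.Properties using (lookup-injective)
open import Function using (_∘_; const)
open import Function.Bundles using (_⇔_; mk⇔; _↔_; Equivalence; Inverse; Injection; mk↔ₛ′)
open import Function.Construct.Composition using (_↔-∘_)
open import Function.Construct.Identity using (↔-id)
open import Function.Construct.Symmetry using (↔-sym)
open import Function.Definitions using (Injective)
open import Function.Properties.Inverse using (↔⇒↣)
open import Relation.Binary.PropositionalEquality
open import Relation.Nullary using (¬_; Dec; yes; no)
open import Relation.Nullary.Decidable using (⌊_⌋; _×-dec_; ¬?; fromWitness; toWitness)

open import Defs

private
  variable
    n k : ℕ
    G H : Graph n

neq-refl : (u : Fin n) → neq u u ≡ false
neq-refl u with u ≟ u
... | yes _ = refl
... | no u≢u = ⊥-elim (u≢u refl)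

neq-≢ : {u v : Fin n} → u ≢ v → neq u v ≡ true
neq-≢ {u = u} {v} u≢v with u ≟ v
... | yes u≡v = ⊥-elim (u≢v u≡v)
... | no _ = refl

neq⇒≢ : {u v : Fin n} → neq u v ≡ true → u ≢ v
neq⇒≢ {u = u} eq refl with () ← trans (sym eq) (neq-refl u)

neq-injective : {f : Fin n → Fin k} → Injective _≡_ _≡_ f →
                (u v : Fin n) → neq u v ≡ neq (f u) (f v)
neq-injective {f = f} inj u v with u ≟ v | f u ≟ f v
... | yes _ | yes _ = refl
... | no _ | no _ = refl
... | yes u≡v | no fu≢fv = ⊥-elim (fu≢fv (cong f u≡v))
... | no u≢v | yes fu≡fv = ⊥-elim (u≢v (inj fu≡fv))

adj⇒≢ : (G : Graph n) {u v : Fin n} → adj G u v ≡ true → u ≢ v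
adj⇒≢ G {u} uv refl with () ← trans (sym uv) (loopless G u)

adj-swap : (G : Graph n) {u v : Fin n} {b : Bool} → adj G u v ≡ b → adj G v u ≡ b
adj-swap G {u} {v} uv = trans (adj-sym G v u) uv

adj-separates : (G : Graph n) {x y z : Fin n} → adj G x z ≡ true → adj G y z ≡ false → x ≢ y
adj-separates G xz yz refl with () ← trans (sym xz) yz

complement-adj-true : (G : Graph n) {u v : Fin n} → adj (complement G) u v ≡ true → adj G u v ≡ false
complement-adj-true G {u} {v} uv = not-injective (∧-conicalʳ (neq u v) _ uv)

complement-adj-false : (G : Graph n) {u v : Fin n} → u ≢ v →
                       adj (complement G) u v ≡ false → adj G u v ≡ true
complement-adj-false G u≢v uv rewrite neq-≢ u≢v = not-injective uv

≅-sym : G ≅ H → H ≅ G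
≅-sym {G = G} {H = H} (φ , pres) = ↔-sym φ , pres⁻¹
  where
  open Inverse φ
  pres⁻¹ : ∀ u v → adj H u v ≡ adj G (from u) (from v)
  pres⁻¹ u v = begin
    adj H u v                         ≡⟨ sym (cong₂ (adj H) (strictlyInverseˡ u) (strictlyInverseˡ v)) ⟩
    adj H (to (from u)) (to (from v)) ≡⟨ sym (pres (from u) (from v)) ⟩
    adj G (from u) (from v)           ∎
    where open ≡-Reasoning

complement-≅ : G ≅ H → complement G ≅ complement H
complement-≅ (φ , pres) =
  φ , λ u v → cong₂ _∧_ (neq-injective (Injection.injective (↔⇒↣ φ)) u v) (cong not (pres u v))

complement-induced-≅ : {e : Fin k → Fin n} → Injective _≡_ _≡_ e →
                       complement (induced G e) ≅ induced (complement G) e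
complement-induced-≅ {G = G} {e = e} inj = ↔-id _ , same-adj
  where
  same-adj : ∀ u v → adj (complement (induced G e)) u v ≡ adj (induced (complement G) e) u v
  same-adj u v with u ≟ v
  ... | yes refl = sym (∧-zeroʳ _)
  ... | no u≢v = trans (cong not (∧-identityʳ _))
                       (sym (trans (∧-identityʳ _) (cong (_∧ _) (neq-≢ (u≢v ∘ inj)))))

record NonIsolatedClique (H : Graph n) : Set where
  constructor non-isolated-clique
  field
    adjacent : ∀ a b c d → adj H a b ≡ true → adj H c d ≡ true → a ≢ c → adj H a c ≡ true
open NonIsolatedClique

NonIsolatedClique-reflect : G ≅ H → NonIsolatedClique H → NonIsolatedClique G
NonIsolatedClique-reflect (φ , pres) cliqueH = non-isolated-clique λ a b c d ab cd a≢c →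
  trans (pres a c) (adjacent cliqueH _ _ _ _ (trans (sym (pres a b)) ab) (trans (sym (pres c d)) cd)
                                             (a≢c ∘ Injection.injective (↔⇒↣ φ)))

NonIsolatedClique-transport : G ≅ H → NonIsolatedClique G → NonIsolatedClique H
NonIsolatedClique-transport {G = G} {H = H} iso = NonIsolatedClique-reflect (≅-sym {G = G} {H = H} iso)

NonIsolatedClique-induced : {e : Fin k → Fin n} → Injective _≡_ _≡_ e →
                            NonIsolatedClique G → NonIsolatedClique (induced G e)
NonIsolatedClique-induced {e = e} inj cliqueG = non-isolated-clique λ a b c d ab cd a≢c →
  cong₂ _∧_ (adjacent cliqueG (e a) (e b) (e c) (e d) (∧-conicalˡ _ _ ab) (∧-conicalˡ _ _ cd) (a≢c ∘ inj))
            (neq-≢ a≢c)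

KplusIso-adj⇒<ᵇ : (m ℓ : ℕ) {u v : Fin (m + ℓ)} → adj (KplusIso m ℓ) u v ≡ true → (toℕ u <ᵇ m) ≡ true
KplusIso-adj⇒<ᵇ m ℓ {u} {v} uv = ∧-conicalˡ (toℕ u <ᵇ m) _ (∧-conicalʳ (neq u v) _ uv)

NonIsolatedClique-KplusIso : (m ℓ : ℕ) → NonIsolatedClique (KplusIso m ℓ)
NonIsolatedClique-KplusIso m ℓ = non-isolated-clique λ a b c d ab cd a≢c →
  cong₂ _∧_ (neq-≢ a≢c) (cong₂ _∧_ (KplusIso-adj⇒<ᵇ m ℓ ab) (KplusIso-adj⇒<ᵇ m ℓ cd))

¬NonIsolatedClique : (H : Graph n) (a b c d : Fin n) → adj H a b ≡ true → adj H c d ≡ true → a ≢ c →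
                     adj H a c ≡ false → ¬ NonIsolatedClique H
¬NonIsolatedClique H a b c d ab cd a≢c ac cliqueH
  with () ← trans (sym ac) (adjacent cliqueH a b c d ab cd a≢c)

Forbidden4⇒¬NonIsolatedClique : {H : Graph 4} → Forbidden4 H → ¬ NonIsolatedClique H
Forbidden4⇒¬NonIsolatedClique (inj₁ φ) =
  ¬NonIsolatedClique F0 0F 1F 2F 3F refl refl (λ ()) refl ∘ NonIsolatedClique-transport φ
Forbidden4⇒¬NonIsolatedClique (inj₂ (inj₁ φ)) =
  ¬NonIsolatedClique F1 0F 1F 2F 1F refl refl (λ ()) refl ∘ NonIsolatedClique-transport φ
Forbidden4⇒¬NonIsolatedClique (inj₂ (inj₂ (inj₁ φ))) =
  ¬NonIsolatedClique F2 0F 1F 2F 1F refl refl (λ ()) refl ∘ NonIsolatedClique-transport φ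
Forbidden4⇒¬NonIsolatedClique (inj₂ (inj₂ (inj₂ (inj₁ φ)))) =
  ¬NonIsolatedClique F3 0F 1F 3F 2F refl refl (λ ()) refl ∘ NonIsolatedClique-transport φ
Forbidden4⇒¬NonIsolatedClique (inj₂ (inj₂ (inj₂ (inj₂ φ)))) =
  ¬NonIsolatedClique F4 0F 1F 2F 1F refl refl (λ ()) refl ∘ NonIsolatedClique-transport φ

Forbidden4⇒¬NonIsolatedClique-complement : {H : Graph 4} → Forbidden4 H → ¬ NonIsolatedClique (complement H)
Forbidden4⇒¬NonIsolatedClique-complement {H} (inj₁ φ) =
  ¬NonIsolatedClique (complement F0) 0F 2F 1F 3F refl refl (λ ()) refl
  ∘ NonIsolatedClique-transport (complement-≅ {G = H} {H = F0} φ)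
Forbidden4⇒¬NonIsolatedClique-complement {H} (inj₂ (inj₁ φ)) =
  ¬NonIsolatedClique (complement F1) 0F 2F 1F 3F refl refl (λ ()) refl
  ∘ NonIsolatedClique-transport (complement-≅ {G = H} {H = F1} φ)
Forbidden4⇒¬NonIsolatedClique-complement {H} (inj₂ (inj₂ (inj₁ φ))) =
  ¬NonIsolatedClique (complement F2) 0F 2F 1F 3F refl refl (λ ()) refl
  ∘ NonIsolatedClique-transport (complement-≅ {G = H} {H = F2} φ)
Forbidden4⇒¬NonIsolatedClique-complement {H} (inj₂ (inj₂ (inj₂ (inj₁ φ)))) =
  ¬NonIsolatedClique (complement F3) 0F 3F 1F 3F refl refl (λ ()) refl
  ∘ NonIsolatedClique-transport (complement-≅ {G = H} {H = F3} φ)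
Forbidden4⇒¬NonIsolatedClique-complement {H} (inj₂ (inj₂ (inj₂ (inj₂ φ)))) =
  ¬NonIsolatedClique (complement F4) 0F 2F 1F 3F refl refl (λ ()) refl
  ∘ NonIsolatedClique-transport (complement-≅ {G = H} {H = F4} φ)

InF⇒¬HasForbiddenInduced : (G : Graph n) → InF G → ¬ HasForbiddenInduced G
InF⇒¬HasForbiddenInduced G (m , ℓ , _ , inj₁ iso) (e , inj , forbidden) =
  Forbidden4⇒¬NonIsolatedClique forbidden
    (NonIsolatedClique-induced inj (NonIsolatedClique-reflect {G = G} iso (NonIsolatedClique-KplusIso m ℓ)))
InF⇒¬HasForbiddenInduced G (m , ℓ , _ , inj₂ iso) (e , inj , forbidden) =
  Forbidden4⇒¬NonIsolatedClique-complement {H = induced G e} forbidden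
    (NonIsolatedClique-reflect (complement-induced-≅ {G = G} {e = e} inj)
      (NonIsolatedClique-induced inj
        (NonIsolatedClique-reflect {G = complement G} iso (NonIsolatedClique-KplusIso m ℓ))))

HasInducedP3 : Graph n → Set
HasInducedP3 H = ∃[ a ] ∃[ b ] ∃[ c ] (adj H a b ≡ true × adj H b c ≡ true × adj H a c ≡ false × a ≢ c)

hasInducedP3? : (H : Graph n) → Dec (HasInducedP3 H)
hasInducedP3? H = any? λ a → any? λ b → any? λ c →
  (adj H a b ≟ᵇ true) ×-dec (adj H b c ≟ᵇ true) ×-dec (adj H a c ≟ᵇ false) ×-dec ¬? (a ≟ c)

HasInduced2K2 : Graph n → Set
HasInduced2K2 H = ∃[ a ] ∃[ b ] ∃[ c ] ∃[ d ]
  (adj H a b ≡ true × adj H c d ≡ true ×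
   adj H a c ≡ false × adj H a d ≡ false × adj H b c ≡ false × adj H b d ≡ false)

induced2K2-distinct : (H : Graph n) {a b c d : Fin n} → adj H a b ≡ true → adj H a c ≡ false →
                      adj H a d ≡ false → adj H b c ≡ false → adj H b d ≡ false →
                      a ≢ c × a ≢ d × b ≢ c × b ≢ d
induced2K2-distinct H ab ac ad bc bd =
    adj-separates H ab (adj-swap H bc) , adj-separates H ab (adj-swap H bd)
  , adj-separates H (adj-swap H ab) (adj-swap H ac) , adj-separates H (adj-swap H ab) (adj-swap H ad)

NonIsolatedClique-if-¬P3-¬2K2 : ¬ HasInducedP3 H → ¬ HasInduced2K2 H → NonIsolatedClique H
NonIsolatedClique-if-¬P3-¬2K2 {H = H} noP3 no2K2 = non-isolated-clique adjacent′
  where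
  adjacent′ : ∀ a b c d → adj H a b ≡ true → adj H c d ≡ true → a ≢ c → adj H a c ≡ true
  adjacent′ a b c d ab cd a≢c with adj H a c in ac
  ... | true = refl
  ... | false with adj H b c in bc | adj H a d in ad | adj H b d in bd
  ...   | true  | _     | _     = ⊥-elim (noP3 (a , b , c , ab , bc , ac , a≢c))
  ...   | false | true  | _     = ⊥-elim (noP3 (c , d , a , cd , adj-swap H ad , adj-swap H ac , a≢c ∘ sym))
  ...   | false | false | true  = ⊥-elim (noP3 (a , b , d , ab , bd , ad , d≢a ∘ sym))
    where d≢a = adj-separates H (adj-swap H cd) ac
  ...   | false | false | false = ⊥-elim (no2K2 (a , b , c , d , ab , cd , ac , ad , bc , bd))

-- Graphs with no induced F₀, …, F₄

module _ (G : Graph n) (free : ¬ HasForbiddenInduced G) where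

  noInducedCopy : (H : Graph 4) → (∀ {K} → K ≅ H → Forbidden4 K) → (a b c d : Fin n) →
                  a ≢ b → a ≢ c → a ≢ d → b ≢ c → b ≢ d → c ≢ d →
                  adj G a b ≡ adj H 0F 1F → adj G a c ≡ adj H 0F 2F → adj G a d ≡ adj H 0F 3F →
                  adj G b c ≡ adj H 1F 2F → adj G b d ≡ adj H 1F 3F → adj G c d ≡ adj H 2F 3F → ⊥
  noInducedCopy H forbidden a b c d a≢b a≢c a≢d b≢c b≢d c≢d ab ac ad bc bd cd =
    free (e , e-injective , forbidden {induced G e} (↔-id _ , same-adj))
    where
    e : Fin 4 → Fin n
    e = lookup (a ∷ b ∷ c ∷ d ∷ [])
    e-injective : Injective _≡_ _≡_ e
    e-injective =
      lookup-injective ((a≢b ∷ a≢c ∷ a≢d ∷ []) ∷ (b≢c ∷ b≢d ∷ []) ∷ (c≢d ∷ []) ∷ [] ∷ []) _ _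
    upper : ∀ {x y i j} → adj G x y ≡ adj H i j → adj G x y ∧ true ≡ adj H i j
    upper xy = trans (∧-identityʳ _) xy
    lower : ∀ {x y i j} → adj G x y ≡ adj H i j → adj G y x ∧ true ≡ adj H j i
    lower {x} {y} {i} {j} xy = trans (∧-identityʳ _) (trans (adj-sym G y x) (trans xy (adj-sym H i j)))
    diagonal : ∀ x i → adj G x x ∧ false ≡ adj H i i
    diagonal x i = trans (∧-zeroʳ _) (sym (loopless H i))
    same-adj : ∀ i j → adj (induced G e) i j ≡ adj H i j
    same-adj 0F 0F = diagonal a 0F
    same-adj 0F 1F = upper ab
    same-adj 0F 2F = upper ac
    same-adj 0F 3F = upper ad
    same-adj 1F 0F = lower ab
    same-adj 1F 1F = diagonal b 1F
    same-adj 1F 2F = upper bc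
    same-adj 1F 3F = upper bd
    same-adj 2F 0F = lower ac
    same-adj 2F 1F = lower bc
    same-adj 2F 2F = diagonal c 2F
    same-adj 2F 3F = upper cd
    same-adj 3F 0F = lower ad
    same-adj 3F 1F = lower bd
    same-adj 3F 2F = lower cd
    same-adj 3F 3F = diagonal d 3F

  ¬HasInduced2K2 : ¬ HasInduced2K2 G
  ¬HasInduced2K2 (a , b , c , d , ab , cd , ac , ad , bc , bd)
    with a≢c , a≢d , b≢c , b≢d ← induced2K2-distinct G ab ac ad bc bd =
    noInducedCopy F0 inj₁ a b c d (adj⇒≢ G ab) a≢c a≢d b≢c b≢d (adj⇒≢ G cd) ab ac ad bc bd cd

  ¬HasInduced2K2-complement : ¬ HasInduced2K2 (complement G)
  ¬HasInduced2K2-complement (a , b , c , d , ab , cd , ac , ad , bc , bd)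
    with a≢c , a≢d , b≢c , b≢d ← induced2K2-distinct (complement G) ab ac ad bc bd =
    noInducedCopy F4 (inj₂ ∘ inj₂ ∘ inj₂ ∘ inj₂) a c b d
      a≢c (adj⇒≢ (complement G) ab) a≢d (b≢c ∘ sym) (adj⇒≢ (complement G) cd) b≢d
      (complement-adj-false G a≢c ac) (complement-adj-true G ab) (complement-adj-false G a≢d ad)
      (adj-swap G (complement-adj-false G b≢c bc)) (complement-adj-true G cd) (complement-adj-false G b≢d bd)

  module _ {p q r : Fin n} (pq : adj G p q ≡ true) (qr : adj G q r ≡ true)
           (pr : adj G p r ≡ false) (p≢r : p ≢ r) where

    private
      noInducedCopy-P3+ : (H : Graph 4) → (∀ {K} → K ≅ H → Forbidden4 K) →
                          ∀ {d} → d ≢ p → d ≢ q → d ≢ r →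
                          adj G p q ≡ adj H 0F 1F → adj G p r ≡ adj H 0F 2F → adj G q r ≡ adj H 1F 2F →
                          adj G d p ≡ adj H 0F 3F → adj G d q ≡ adj H 1F 3F → adj G d r ≡ adj H 2F 3F → ⊥
      noInducedCopy-P3+ H forbidden {d} d≢p d≢q d≢r pq′ pr′ qr′ dp dq dr =
        noInducedCopy H (λ {K} → forbidden {K}) p q r d
          (adj⇒≢ G pq) p≢r (d≢p ∘ sym) (adj⇒≢ G qr) (d≢q ∘ sym) (d≢r ∘ sym)
          pq′ pr′ (adj-swap G dp) qr′ (adj-swap G dq) (adj-swap G dr)

    P3-centre-dominating : ∀ d → d ≢ q → adj G d q ≡ true
    P3-centre-dominating d d≢q with d ≟ p | d ≟ r
    ... | yes refl | _        = pq
    ... | no _     | yes refl = adj-swap G qr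
    ... | no d≢p   | no d≢r with adj G d q in dq | adj G d p in dp | adj G d r in dr
    ...   | true  | _     | _     = refl
    ...   | false | false | false = ⊥-elim (noInducedCopy-P3+ F1 (inj₂ ∘ inj₁) d≢p d≢q d≢r pq pr qr dp dq dr)
    ...   | false | false | true  =
      ⊥-elim (noInducedCopy-P3+ F2 (inj₂ ∘ inj₂ ∘ inj₁) d≢p d≢q d≢r pq pr qr dp dq dr)
    ...   | false | true  | true  =
      ⊥-elim (noInducedCopy-P3+ F4 (inj₂ ∘ inj₂ ∘ inj₂ ∘ inj₂) d≢p d≢q d≢r pq pr qr dp dq dr)
    ...   | false | true  | false = ⊥-elim (noInducedCopy F2 (inj₂ ∘ inj₂ ∘ inj₁) d p q r
      d≢p d≢q d≢r (adj⇒≢ G pq) p≢r (adj⇒≢ G qr) dp dq dr pq pr qr)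

    noInducedK2+K1 : {x y z : Fin n} → adj G x y ≡ true → adj G x z ≡ false → adj G y z ≡ false → ⊥
    noInducedK2+K1 {x} {y} {z} xy xz yz =
      noInducedCopy F3 (inj₂ ∘ inj₂ ∘ inj₂ ∘ inj₁) x y q z
        (adj⇒≢ G xy) x≢q x≢z y≢q y≢z (z≢q ∘ sym)
        xy (P3-centre-dominating x x≢q) xz (P3-centre-dominating y y≢q) yz
        (adj-swap G (P3-centre-dominating z z≢q))
      where
      x≢z = adj-separates G xy (adj-swap G yz)
      y≢z = adj-separates G (adj-swap G xy) (adj-swap G xz)
      x≢q : x ≢ q
      x≢q refl with () ← trans (sym (adj-swap G (P3-centre-dominating z (x≢z ∘ sym)))) xz
      y≢q : y ≢ q
      y≢q refl with () ← trans (sym (adj-swap G (P3-centre-dominating z (y≢z ∘ sym)))) yz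
      z≢q : z ≢ q
      z≢q refl with () ← trans (sym (P3-centre-dominating x x≢z)) xz

  HasInducedP3⇒¬HasInducedP3-complement : HasInducedP3 G → ¬ HasInducedP3 (complement G)
  HasInducedP3⇒¬HasInducedP3-complement (p , q , r , pq , qr , pr , p≢r) (x , y , z , xy , yz , xz , x≢z) =
    noInducedK2+K1 pq qr pr p≢r (complement-adj-false G x≢z xz) (complement-adj-true G xy)
                   (adj-swap G (complement-adj-true G yz))

-- Splitting the vertices along a Boolean predicate

isLeft : {A B : Set} → A ⊎ B → Bool
isLeft = [ const true , const false ]′

record Partition (c : Fin n → Bool) : Set where
  field
    m ℓ          : ℕ
    split        : Fin n ↔ (Fin m ⊎ Fin ℓ)
    isLeft-split : ∀ u → c u ≡ isLeft (Inverse.to split u)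

Partition-swap : {c : Fin n → Bool} → Partition c → Partition (not ∘ c)
Partition-swap P = record
  { m = ℓ ; ℓ = m ; split = swap-↔ ↔-∘ split
  ; isLeft-split = λ u → trans (cong not (isLeft-split u)) (not-isLeft (Inverse.to split u)) }
  where
  open Partition P
  not-isLeft : ∀ {A B : Set} (s : A ⊎ B) → not (isLeft s) ≡ isLeft (swap s)
  not-isLeft (inj₁ _) = refl
  not-isLeft (inj₂ _) = refl

Partition-cong : {c c′ : Fin n → Bool} → (∀ u → c u ≡ c′ u) → Partition c → Partition c′
Partition-cong c≗c′ P = record
  { m = m ; ℓ = ℓ ; split = split ; isLeft-split = λ u → trans (sym (c≗c′ u)) (isLeft-split u) }
  where open Partition P

Partition-consˡ : {c : Fin (suc n) → Bool} → c zero ≡ true → Partition (c ∘ suc) → Partition c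
Partition-consˡ {c = c} c₀ P = record
  { m = suc m ; ℓ = ℓ
  ; split = mk↔ₛ′ to′ from′ to∘from′ from∘to′
  ; isLeft-split = isLeft-split′ }
  where
  open Partition P
  open Inverse split
  to′ : Fin (suc _) → Fin (suc m) ⊎ Fin ℓ
  to′ zero    = inj₁ zero
  to′ (suc u) = map₁ suc (to u)
  from′ : Fin (suc m) ⊎ Fin ℓ → Fin (suc _)
  from′ (inj₁ zero)    = zero
  from′ (inj₁ (suc x)) = suc (from (inj₁ x))
  from′ (inj₂ y)       = suc (from (inj₂ y))
  to∘from′ : ∀ s → to′ (from′ s) ≡ s
  to∘from′ (inj₁ zero)    = refl
  to∘from′ (inj₁ (suc x)) = cong (map₁ suc) (strictlyInverseˡ (inj₁ x))
  to∘from′ (inj₂ y)       = cong (map₁ suc) (strictlyInverseˡ (inj₂ y))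
  from′-map₁ : ∀ s → from′ (map₁ suc s) ≡ suc (from s)
  from′-map₁ (inj₁ _) = refl
  from′-map₁ (inj₂ _) = refl
  from∘to′ : ∀ u → from′ (to′ u) ≡ u
  from∘to′ zero    = refl
  from∘to′ (suc u) = trans (from′-map₁ (to u)) (cong suc (strictlyInverseʳ u))
  isLeft-map₁ : ∀ s → isLeft s ≡ isLeft (map₁ suc s)
  isLeft-map₁ (inj₁ _) = refl
  isLeft-map₁ (inj₂ _) = refl
  isLeft-split′ : ∀ u → c u ≡ isLeft (to′ u)
  isLeft-split′ zero    = c₀
  isLeft-split′ (suc u) = trans (isLeft-split u) (isLeft-map₁ (to u))

Partition-consʳ : {c : Fin (suc n) → Bool} → c zero ≡ false → Partition (c ∘ suc) → Partition c
Partition-consʳ {c = c} c₀ P =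
  Partition-cong (not-involutive ∘ c) (Partition-swap (Partition-consˡ (cong not c₀) (Partition-swap P)))

partition : (c : Fin n → Bool) → Partition c
partition {zero} c = record
  { m = 0 ; ℓ = 0
  ; split = mk↔ₛ′ (λ ()) [ (λ ()) , (λ ()) ]′ (λ { (inj₁ ()) ; (inj₂ ()) }) (λ ())
  ; isLeft-split = λ () }
partition {suc n} c with c zero in c₀
... | true  = Partition-consˡ c₀ (partition (c ∘ suc))
... | false = Partition-consʳ c₀ (partition (c ∘ suc))

isLeft-join : (m ℓ : ℕ) (s : Fin m ⊎ Fin ℓ) → isLeft s ≡ (toℕ (join m ℓ s) <ᵇ m)
isLeft-join m ℓ (inj₁ x) rewrite toℕ-↑ˡ x ℓ = sym (Equivalence.to T-≡ (<⇒<ᵇ (toℕ<n x)))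
isLeft-join m ℓ (inj₂ y) rewrite toℕ-↑ʳ m y = sym (m+n<ᵇm m (toℕ y))
  where
  m+n<ᵇm : ∀ m n → (m + n <ᵇ m) ≡ false
  m+n<ᵇm zero    n = refl
  m+n<ᵇm (suc m) n = m+n<ᵇm m n

cliqueOn⇒≅KplusIso : (c : Fin n → Bool) → (∀ u v → adj H u v ≡ neq u v ∧ (c u ∧ c v)) →
                     {w : Fin n} → c w ≡ true → ∃[ m ] ∃[ ℓ ] (1 ≤ m × H ≅ KplusIso m ℓ)
cliqueOn⇒≅KplusIso {H = H} c adj≡ {w} cw = m , ℓ , 1≤m , φ , pres
  where
  open Partition (partition c)
  φ : _ ↔ Fin (m + ℓ)
  φ = ↔-sym +↔⊎ ↔-∘ split
  c≡<ᵇ : ∀ u → c u ≡ (toℕ (Inverse.to φ u) <ᵇ m)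
  c≡<ᵇ u = trans (isLeft-split u) (isLeft-join m ℓ (Inverse.to split u))
  pres : ∀ u v → adj H u v ≡ adj (KplusIso m ℓ) (Inverse.to φ u) (Inverse.to φ v)
  pres u v = trans (adj≡ u v)
    (cong₂ _∧_ (neq-injective (Injection.injective (↔⇒↣ φ)) u v) (cong₂ _∧_ (c≡<ᵇ u) (c≡<ᵇ v)))
  1≤m : 1 ≤ m
  1≤m with Inverse.to split w | isLeft-split w
  ... | inj₁ x | _ = ≤-trans (s≤s z≤n) (toℕ<n x)
  ... | inj₂ _ | cw≡false with () ← trans (sym cw) cw≡false

edgeless⇒≅KplusIso : {H : Graph (suc k)} → (∀ u v → adj H u v ≡ false) → H ≅ KplusIso 1 k
edgeless⇒≅KplusIso {k = k} noEdge = ↔-id _ , λ u v → trans (noEdge u v) (sym (KplusIso-edgeless u v))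
  where
  KplusIso-edgeless : ∀ u v → adj (KplusIso 1 k) u v ≡ false
  KplusIso-edgeless zero    zero    = refl
  KplusIso-edgeless zero    (suc v) = refl
  KplusIso-edgeless (suc u) v       = ∧-zeroʳ _

hasNeighbour : Graph n → Fin n → Bool
hasNeighbour H u = ⌊ any? (λ v → adj H u v ≟ᵇ true) ⌋

hasNeighbour-intro : (H : Graph n) {u v : Fin n} → adj H u v ≡ true → hasNeighbour H u ≡ true
hasNeighbour-intro H uv = Equivalence.to T-≡ (fromWitness (_ , uv))

hasNeighbour-elim : (H : Graph n) {u : Fin n} → hasNeighbour H u ≡ true → ∃[ v ] adj H u v ≡ true
hasNeighbour-elim H hu = toWitness (Equivalence.from T-≡ hu)

NonIsolatedClique⇒cliqueOn : NonIsolatedClique H →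
                              ∀ u v → adj H u v ≡ neq u v ∧ (hasNeighbour H u ∧ hasNeighbour H v)
NonIsolatedClique⇒cliqueOn {H = H} clique u v with adj H u v in uv
... | true = sym (cong₂ _∧_ (neq-≢ (adj⇒≢ H uv))
                            (cong₂ _∧_ (hasNeighbour-intro H uv) (hasNeighbour-intro H (adj-swap H uv))))
... | false with neq u v in u≢v | hasNeighbour H u in hu | hasNeighbour H v in hv
...   | false | _     | _     = refl
...   | true  | false | _     = refl
...   | true  | true  | false = refl
...   | true  | true  | true
  with (a , ua) ← hasNeighbour-elim H hu | (b , vb) ← hasNeighbour-elim H hv
  with () ← trans (sym uv) (adjacent clique u a v b ua vb (neq⇒≢ u≢v))

NonIsolatedClique⇒≅KplusIso : {H : Graph n} → 1 ≤ n → NonIsolatedClique H →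
                              ∃[ m ] ∃[ ℓ ] (1 ≤ m × H ≅ KplusIso m ℓ)
NonIsolatedClique⇒≅KplusIso {H = H} (s≤s z≤n) clique with any? (λ u → hasNeighbour H u ≟ᵇ true)
... | yes (w , hw) = cliqueOn⇒≅KplusIso {H = H} (hasNeighbour H) (NonIsolatedClique⇒cliqueOn clique) hw
-- Without edges the clique is a single vertex, which needs 1 ≤ n.
... | no isolated = 1 , _ , ≤-refl , edgeless⇒≅KplusIso {H = H} noEdge
  where
  noEdge : ∀ u v → adj H u v ≡ false
  noEdge u v with adj H u v in uv
  ... | true  = ⊥-elim (isolated (u , hasNeighbour-intro H uv))
  ... | false = refl

¬HasForbiddenInduced⇒InF : (G : Graph n) → 1 ≤ n → ¬ HasForbiddenInduced G → InF G
¬HasForbiddenInduced⇒InF G 1≤n free with hasInducedP3? G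
... | no noP3 = map₂ (map₂ (map₂ inj₁)) (NonIsolatedClique⇒≅KplusIso {H = G} 1≤n
      (NonIsolatedClique-if-¬P3-¬2K2 noP3 (¬HasInduced2K2 G free)))
... | yes P3 = map₂ (map₂ (map₂ inj₂)) (NonIsolatedClique⇒≅KplusIso {H = complement G} 1≤n
      (NonIsolatedClique-if-¬P3-¬2K2 (HasInducedP3⇒¬HasInducedP3-complement G free P3)
                                     (¬HasInduced2K2-complement G free)))

lemma3p1 : ∀ (n : ℕ) → 1 ≤ n → (G : Graph n) → InF G ⇔ (¬ HasForbiddenInduced G)
lemma3p1 n 1≤n G = mk⇔ (InF⇒¬HasForbiddenInduced G) (¬HasForbiddenInduced⇒InF G 1≤n)
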